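{- Let $\mathcal{S}$ be the structure of all intentic states over $\mathcal{L}$, endowed with the relations $\leq_\Vdash$ and $\leq_F$. Then: (a) $\leq_\Vdash$ is a preorder. (b) $\leq_F$ is a locally directed preorder, that is, a preorder such that $\forall u, v, w \in \mathcal{S} \,\big( (u \leq_F v \wedge u \leq_F w) \rightarrow \exists s \in \mathcal{S} \, (v \leq_F s \wedge w \leq_F s) \big)$. (c) $\forall u, v, w \in \mathcal{S} \,\big( (u \leq_\Vdash v \wedge u \leq_F w) \rightarrow \exists s \in \mathcal{S} \, (v \leq_F s \wedge w \leq_\Vdash s) \big)$.
   Context: Let $\mathcal{L}$ be a purely relational first-order language; $\mathcal{L}_0=\mathcal{L}$, $\mathcal{L}_{i+1}$ is $\mathcal{L}_i$ plus a constant $c_\varphi$ for each $\varphi(x)\in\mathcal{L}_i$ with sole free variable $x$, $\mathcal{L}_\omega=\bigcup_i\mathcal{L}_i$. Non-hypothetical logic, with deductive relation $\vdash_{\mathrm{NH}}$ (in the paper: $\vdash$ with a struck-through subscript $H$), is classical natural deduction (LEM as axiom schema) without ${\rightarrow}I$, with $\vee E$, $\exists E$ replaced by: from $\varphi\vee\psi$, $\varphi\rightarrow\theta$, $\psi\rightarrow\theta$ infer $\theta$; from $\exists x\varphi(x)$, $\varphi(c_\varphi)\rightarrow\theta$ infer $\theta$. For finite $d$, $[d]$ is the $\vdash_{\mathrm{NH}}$-closure of $d$; $d+\varphi=d\cup\{\varphi\}$. A basic intentic state is a set $b$ of $\mathcal{L}_i$-formulas (some $i$) with $b=[d]$ for some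 finite $d\subseteq b$. An intentic state $u$ is (by $\in$-recursion) a pair $\langle b(u),H(u)\rangle$ with $b(u)$ basic and $H(u)$ a finite set of intentic states each satisfying $b(u)+\varphi=b(s)$ for some $\varphi\in\mathcal{L}_\omega$. $\mathrm{MT}(u)$ is the $\subseteq$-least set with: (i) $b(u)\subseteq\mathrm{MT}(u)$; (ii) for $s\in H(u)$, if $b(u)+\varphi\vdash_{\mathrm{NH}} b(s)$ and $\theta\in\mathrm{MT}(s)$ then $(\varphi\rightarrow\theta)\in\mathrm{MT}(u)$; (iii) $\mathrm{MT}(u)$ is closed under $\vdash_{\mathrm{NH}}$. $u\leq_\Vdash v$ means $\mathrm{MT}(u)\subseteq\mathrm{MT}(v)$. $u\leq_F v$ means (by $\in$-recursion) $b(u)=b(v)$ and each $s\in H(u)$ has some $t\in H(v)$ with $s\leq_F t$. -}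

module Defs where

open import Level using (Level; 0ℓ) renaming (suc to lsuc)
open import Data.Nat using (ℕ; zero; suc; _<_; _≤_; _⊔_)
open import Data.Fin using (Fin)
open import Data.Vec using (Vec; []; _∷_)
open import Data.List using (List; []; _∷_; map)
open import Data.List.Membership.Propositional using (_∈_)
open import Data.List.Relation.Unary.All using (All)
open import Data.Product using (Σ; _×_; _,_; proj₁; proj₂; Σ-syntax)
open import Data.Unit using (⊤)
open import Data.Sum using (_⊎_)
open import Relation.Unary using (Pred; _⊆_; _≐_; _∪_; ｛_｝)
open import Relation.Binary.PropositionalEquality using (_≡_)

module Lang (Rel : Set) (arity : Rel → ℕ) where

  infixr 6 _⇒_
  infixr 7 _∨'_
  infixr 8 _∧'_

  -- Raw syntax of L_ω with (unscoped) de Bruijn variables.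
  -- A constant  con φ  is the constant c_φ for the formula φ(x), where x is
  -- de Bruijn variable 0.  Well-formedness (φ has no free variable other
  -- than x) is imposed by the predicate WF below.
  data Term : Set
  data Formula : Set

  data Term where
    var : ℕ → Term
    con : Formula → Term

  data Formula where
    rel  : (R : Rel) → Vec Term (arity R) → Formula
    ⊥'   : Formula
    _∧'_ : Formula → Formula → Formula
    _∨'_ : Formula → Formula → Formula
    _⇒_  : Formula → Formula → Formula
    ∀'   : Formula → Formula
    ∃'   : Formula → Formula

  ¬' : Formula → Formula
  ¬' φ = φ ⇒ ⊥'

  FVT : ℕ → Term → Set
  FVTs : ∀ {k} → ℕ → Vec Term k → Set
  FV : ℕ → Formula → Set
  FVT n (var k) = k < n
  FVT n (con φ) = ⊤
  FVTs n [] = ⊤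
  FVTs n (t ∷ ts) = FVT n t × FVTs n ts
  FV n (rel R ts) = FVTs n ts
  FV n ⊥' = ⊤
  FV n (φ ∧' ψ) = FV n φ × FV n ψ
  FV n (φ ∨' ψ) = FV n φ × FV n ψ
  FV n (φ ⇒ ψ) = FV n φ × FV n ψ
  FV n (∀' φ) = FV (suc n) φ
  FV n (∃' φ) = FV (suc n) φ

  WFT : Term → Set
  WFTs : ∀ {k} → Vec Term k → Set
  WF : Formula → Set
  WFT (var k) = ⊤
  WFT (con φ) = FV 1 φ × WF φ
  WFTs [] = ⊤
  WFTs (t ∷ ts) = WFT t × WFTs ts
  WF (rel R ts) = WFTs ts
  WF ⊥' = ⊤
  WF (φ ∧' ψ) = WF φ × WF ψ
  WF (φ ∨' ψ) = WF φ × WF ψ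
  WF (φ ⇒ ψ) = WF φ × WF ψ
  WF (∀' φ) = WF φ
  WF (∃' φ) = WF φ

  -- the least i with the formula in L_i (constant c_φ with φ ∈ L_i lies in L_{i+1})
  levelT : Term → ℕ
  levelTs : ∀ {k} → Vec Term k → ℕ
  level : Formula → ℕ
  levelT (var k) = 0
  levelT (con φ) = suc (level φ)
  levelTs [] = 0
  levelTs (t ∷ ts) = levelT t ⊔ levelTs ts
  level (rel R ts) = levelTs ts
  level ⊥' = 0
  level (φ ∧' ψ) = level φ ⊔ level ψ
  level (φ ∨' ψ) = level φ ⊔ level ψ
  level (φ ⇒ ψ) = level φ ⊔ level ψ
  level (∀' φ) = level φ
  level (∃' φ) = level φ

  InL : ℕ → Formula → Set
  InL i φ = WF φ × level φ ≤ i

  shiftT : Term → Term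
  shiftT (var k) = var (suc k)
  shiftT (con φ) = con φ

  exts : (ℕ → Term) → ℕ → Term
  exts σ zero = var zero
  exts σ (suc k) = shiftT (σ k)

  substT : (ℕ → Term) → Term → Term
  substT σ (var k) = σ k
  substT σ (con φ) = con φ

  substTs : ∀ {k} → (ℕ → Term) → Vec Term k → Vec Term k
  substTs σ [] = []
  substTs σ (t ∷ ts) = substT σ t ∷ substTs σ ts

  substF : (ℕ → Term) → Formula → Formula
  substF σ (rel R ts) = rel R (substTs σ ts)
  substF σ ⊥' = ⊥'
  substF σ (φ ∧' ψ) = substF σ φ ∧' substF σ ψ
  substF σ (φ ∨' ψ) = substF σ φ ∨' substF σ ψ
  substF σ (φ ⇒ ψ) = substF σ φ ⇒ substF σ ψ
  substF σ (∀' φ) = ∀' (substF (exts σ) φ)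
  substF σ (∃' φ) = ∃' (substF (exts σ) φ)

  shiftF : Formula → Formula
  shiftF = substF (λ k → var (suc k))

  sub0 : Term → ℕ → Term
  sub0 t zero = t
  sub0 t (suc k) = var k

  _[_] : Formula → Term → Formula
  φ [ t ] = substF (sub0 t) φ

  -- Non-hypothetical natural deduction: derivations whose open assumptions
  -- are among the finite list Δ.  Classical (LEM axiom), no →I; ∨E and ∃E
  -- replaced by their non-hypothetical versions.  ¬φ abbreviates φ → ⊥.
  infix 4 _⊩_
  data _⊩_ (Δ : List Formula) : Formula → Set where
    ass  : ∀ {φ} → φ ∈ Δ → Δ ⊩ φ
    lem  : ∀ {φ} → WF φ → Δ ⊩ φ ∨' ¬' φ
    ∧I   : ∀ {φ ψ} → Δ ⊩ φ → Δ ⊩ ψ → Δ ⊩ φ ∧' ψ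
    ∧E₁  : ∀ {φ ψ} → Δ ⊩ φ ∧' ψ → Δ ⊩ φ
    ∧E₂  : ∀ {φ ψ} → Δ ⊩ φ ∧' ψ → Δ ⊩ ψ
    ∨I₁  : ∀ {φ ψ} → Δ ⊩ φ → WF ψ → Δ ⊩ φ ∨' ψ
    ∨I₂  : ∀ {φ ψ} → WF φ → Δ ⊩ ψ → Δ ⊩ φ ∨' ψ
    ∨E'  : ∀ {φ ψ θ} → Δ ⊩ φ ∨' ψ → Δ ⊩ φ ⇒ θ → Δ ⊩ ψ ⇒ θ → Δ ⊩ θ
    ⇒E   : ∀ {φ ψ} → Δ ⊩ φ ⇒ ψ → Δ ⊩ φ → Δ ⊩ ψ
    ⊥E   : ∀ {φ} → Δ ⊩ ⊥' → WF φ → Δ ⊩ φ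
    -- ∀I: the eigenvariable (de Bruijn 0) is fresh for the shifted assumptions
    ∀I   : ∀ {φ} → map shiftF Δ ⊩ φ → Δ ⊩ ∀' φ
    ∀E   : ∀ {φ t} → Δ ⊩ ∀' φ → WFT t → Δ ⊩ φ [ t ]
    ∃I   : ∀ {φ t} → WFT t → Δ ⊩ φ [ t ] → Δ ⊩ ∃' φ
    -- from ∃xφ(x) and φ(c_φ) → θ infer θ   (c_φ exists: φ has sole free variable x)
    ∃E'  : ∀ {φ θ} → Δ ⊩ ∃' φ → FV 1 φ → Δ ⊩ (φ [ con φ ]) ⇒ θ → Δ ⊩ θ

  infix 4 _⊢_
  _⊢_ : ∀ {ℓ} → Pred Formula ℓ → Formula → Set ℓ
  Γ ⊢ φ = Σ[ Δ ∈ List Formula ] (All Γ Δ × Δ ⊩ φ)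

  ⟪_⟫ : List Formula → Pred Formula 0ℓ
  ⟪ d ⟫ φ = φ ∈ d

  Closure : ℕ → Pred Formula 0ℓ → Pred Formula 0ℓ
  Closure i Γ φ = InL i φ × (Γ ⊢ φ)

  Basic : Pred Formula 0ℓ → Set
  Basic b = Σ[ i ∈ ℕ ] Σ[ d ∈ List Formula ] (All b d × b ≐ Closure i ⟪ d ⟫)

  Plus : Pred Formula 0ℓ → Pred Formula 0ℓ → Set
  Plus b b' = Σ[ φ ∈ Formula ] Σ[ j ∈ ℕ ]
    ((b ⊆ InL j) × InL j φ × b' ≐ Closure j (b ∪ ｛ φ ｝))

  data PreState : Set₁ where
    ⟨_,_⟩ : Pred Formula 0ℓ → List PreState → PreState

  bOf : PreState → Pred Formula 0ℓ
  bOf ⟨ b , H ⟩ = b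

  HOf : PreState → List PreState
  HOf ⟨ b , H ⟩ = H

  IsState : PreState → Set
  IsStates : Pred Formula 0ℓ → List PreState → Set
  IsState ⟨ b , H ⟩ = Basic b × IsStates b H
  IsStates b [] = ⊤
  IsStates b (s ∷ H) = (IsState s × Plus b (bOf s)) × IsStates b H

  State : Set₁
  State = Σ PreState IsState

  data MT : PreState → Pred Formula (lsuc 0ℓ) where
    base : ∀ {u φ} → bOf u φ → MT u φ
    hyp  : ∀ {u s φ θ} → s ∈ HOf u → WF φ →
           (∀ {ψ} → bOf s ψ → (bOf u ∪ ｛ φ ｝) ⊢ ψ) →
           MT s θ → MT u (φ ⇒ θ)
    ded  : ∀ {u φ} → MT u ⊢ φ → MT u φ

  _≤⊩_ : State → State → Set₁
  u ≤⊩ v = MT (proj₁ u) ⊆ MT (proj₁ v)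

  _≤Fp_ : PreState → PreState → Set₁
  ≤Fs : List PreState → List PreState → Set₁
  ⟨ b , H ⟩ ≤Fp ⟨ b' , H' ⟩ = (b ≐ b') × ≤Fs H H'
  ≤Fs [] H' = Level.Lift (lsuc 0ℓ) ⊤
  ≤Fs (s ∷ H) H' = (Σ[ t ∈ PreState ] (t ∈ H' × s ≤Fp t)) × ≤Fs H H'

  _≤F_ : State → State → Set₁
  u ≤F v = proj₁ u ≤Fp proj₁ v

  LocallyDirected : (State → State → Set₁) → Set₁
  LocallyDirected _≤_ = ∀ u v w → u ≤ v → u ≤ w → Σ[ s ∈ State ] (v ≤ s × w ≤ s)

{-# OPTIONS --safe #-}
-- Parts (a) and (b) are bookkeeping: MT-inclusion is a preorder, ≤F is reflexive and
-- transitive by recursion on the trees of hypotheticals, and two ≤F-extensions v, w of u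
-- share the base b(u), so ⟨ b(v) , H(v) ++ H(w) ⟩ lies above both.
--
-- For (c) write b(u) = [d] and δ = ⋀ d.  Then δ ∈ MT(u) ⊆ MT(v), and b(w) = b(u) lies
-- inside b(v) + δ.  Rebasing a state onto a larger basic set, recursively replacing each
-- hypothetical b + φ by b' + φ, can only enlarge its MT.  So w, rebased onto b(v) + δ,
-- can be adjoined to v as a new hypothetical; in the resulting s ≥F v every χ ∈ MT(w)
-- gives δ → χ ∈ MT(s), hence χ ∈ MT(s) by modus ponens.
--
-- Rebasing needs cut for ⊢_NH, and since ∀I shifts the assumptions, cut in turn needs
-- closure of derivations under substitution.
module Submission where

open import Defs
open import Level using (0ℓ; lift)
open import Data.Nat using (ℕ; zero; suc; _<_; _≤_; _⊔_; s≤s; z≤n)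
open import Data.Nat.Properties using (≤-refl; ≤-trans; m≤m⊔n; m≤n⊔m; ⊔-lub)
open import Data.Vec using (Vec; []; _∷_)
open import Data.List using (List; []; _∷_; map; _++_)
open import Data.List.Membership.Propositional using (_∈_)
open import Data.List.Membership.Propositional.Properties using (∈-map⁺; ∈-map⁻; ∈-++⁺ˡ; ∈-++⁺ʳ)
open import Data.List.Relation.Unary.Any using (here; there)
open import Data.List.Relation.Unary.All as All using (All; []; _∷_)
open import Data.List.Relation.Unary.All.Properties using (++⁺)
open import Data.Product using (_×_; _,_; proj₁; proj₂; Σ-syntax)
open import Data.Sum as Sum using (inj₁; inj₂)
open import Data.Unit using (tt)
open import Relation.Unary using (Pred; _⊆_; _≐_; _∪_; ｛_｝)
open import Relation.Unary.Properties using (⊆-trans; ≐-refl; ≐-sym; ≐-trans)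
open import Relation.Binary.PropositionalEquality
  using (_≡_; _≗_; refl; cong; cong₂; sym; trans; subst; isEquivalence; module ≡-Reasoning)
open import Relation.Binary.Structures using (IsPreorder)

module IntenticStates (Rel : Set) (arity : Rel → ℕ) where
  open Lang Rel arity

  Subst : Set
  Subst = ℕ → Term

  variable
    n i j k : ℕ
    σ τ : Subst
    φ ψ δ : Formula
    Δ Θ : List Formula
    Γ Γ' b b' c : Pred Formula 0ℓ
    t : PreState
    H H' H'' : List PreState

  ↑ : Subst
  ↑ k = var (suc k)

  _⊙_ : Subst → Subst → Subst
  (σ ⊙ τ) k = substT σ (τ k)

  substT-cong : σ ≗ τ → ∀ t → substT σ t ≡ substT τ t
  substT-cong eq (var k) = eq k
  substT-cong eq (con φ) = refl

  exts-cong : σ ≗ τ → exts σ ≗ exts τ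
  exts-cong eq zero = refl
  exts-cong eq (suc k) = cong shiftT (eq k)

  substTs-cong : σ ≗ τ → (ts : Vec Term n) → substTs σ ts ≡ substTs τ ts
  substTs-cong eq [] = refl
  substTs-cong eq (t ∷ ts) = cong₂ _∷_ (substT-cong eq t) (substTs-cong eq ts)

  substF-cong : σ ≗ τ → ∀ φ → substF σ φ ≡ substF τ φ
  substF-cong eq (rel R ts) = cong (rel R) (substTs-cong eq ts)
  substF-cong eq ⊥' = refl
  substF-cong eq (φ ∧' ψ) = cong₂ _∧'_ (substF-cong eq φ) (substF-cong eq ψ)
  substF-cong eq (φ ∨' ψ) = cong₂ _∨'_ (substF-cong eq φ) (substF-cong eq ψ)
  substF-cong eq (φ ⇒ ψ) = cong₂ _⇒_ (substF-cong eq φ) (substF-cong eq ψ)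
  substF-cong eq (∀' φ) = cong ∀' (substF-cong (exts-cong eq) φ)
  substF-cong eq (∃' φ) = cong ∃' (substF-cong (exts-cong eq) φ)

  AgreeBelow : ℕ → Subst → Subst → Set
  AgreeBelow n σ τ = ∀ k → k < n → σ k ≡ τ k

  exts-agree : AgreeBelow n σ τ → AgreeBelow (suc n) (exts σ) (exts τ)
  exts-agree eq zero _ = refl
  exts-agree eq (suc k) (s≤s k<n) = cong shiftT (eq k k<n)

  substT-cong-FV : AgreeBelow n σ τ → ∀ t → FVT n t → substT σ t ≡ substT τ t
  substT-cong-FV eq (var k) k<n = eq k k<n
  substT-cong-FV eq (con φ) _ = refl

  substTs-cong-FV : AgreeBelow n σ τ → (ts : Vec Term k) → FVTs n ts → substTs σ ts ≡ substTs τ ts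
  substTs-cong-FV eq [] _ = refl
  substTs-cong-FV eq (t ∷ ts) (fv , fvs) = cong₂ _∷_ (substT-cong-FV eq t fv) (substTs-cong-FV eq ts fvs)

  substF-cong-FV : AgreeBelow n σ τ → ∀ φ → FV n φ → substF σ φ ≡ substF τ φ
  substF-cong-FV eq (rel R ts) fv = cong (rel R) (substTs-cong-FV eq ts fv)
  substF-cong-FV eq ⊥' _ = refl
  substF-cong-FV eq (φ ∧' ψ) (fv , fv') = cong₂ _∧'_ (substF-cong-FV eq φ fv) (substF-cong-FV eq ψ fv')
  substF-cong-FV eq (φ ∨' ψ) (fv , fv') = cong₂ _∨'_ (substF-cong-FV eq φ fv) (substF-cong-FV eq ψ fv')
  substF-cong-FV eq (φ ⇒ ψ) (fv , fv') = cong₂ _⇒_ (substF-cong-FV eq φ fv) (substF-cong-FV eq ψ fv')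
  substF-cong-FV eq (∀' φ) fv = cong ∀' (substF-cong-FV (exts-agree eq) φ fv)
  substF-cong-FV eq (∃' φ) fv = cong ∃' (substF-cong-FV (exts-agree eq) φ fv)

  substT-exts-shiftT : ∀ σ t → substT (exts σ) (shiftT t) ≡ shiftT (substT σ t)
  substT-exts-shiftT σ (var k) = refl
  substT-exts-shiftT σ (con φ) = refl

  substT-↑ : ∀ t → substT ↑ t ≡ shiftT t
  substT-↑ (var k) = refl
  substT-↑ (con φ) = refl

  substT-sub0-shiftT : ∀ u t → substT (sub0 u) (shiftT t) ≡ t
  substT-sub0-shiftT u (var k) = refl
  substT-sub0-shiftT u (con φ) = refl

  exts-⊙ : exts σ ⊙ exts τ ≗ exts (σ ⊙ τ)
  exts-⊙ zero = refl
  exts-⊙ {σ} {τ} (suc k) = substT-exts-shiftT σ (τ k)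

  substT-⊙ : ∀ t → substT σ (substT τ t) ≡ substT (σ ⊙ τ) t
  substT-⊙ (var k) = refl
  substT-⊙ (con φ) = refl

  substTs-⊙ : (ts : Vec Term n) → substTs σ (substTs τ ts) ≡ substTs (σ ⊙ τ) ts
  substTs-⊙ [] = refl
  substTs-⊙ (t ∷ ts) = cong₂ _∷_ (substT-⊙ t) (substTs-⊙ ts)

  substF-⊙ : ∀ φ → substF σ (substF τ φ) ≡ substF (σ ⊙ τ) φ
  substF-⊙ (rel R ts) = cong (rel R) (substTs-⊙ ts)
  substF-⊙ ⊥' = refl
  substF-⊙ (φ ∧' ψ) = cong₂ _∧'_ (substF-⊙ φ) (substF-⊙ ψ)
  substF-⊙ (φ ∨' ψ) = cong₂ _∨'_ (substF-⊙ φ) (substF-⊙ ψ)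
  substF-⊙ (φ ⇒ ψ) = cong₂ _⇒_ (substF-⊙ φ) (substF-⊙ ψ)
  substF-⊙ (∀' φ) = cong ∀' (trans (substF-⊙ φ) (substF-cong exts-⊙ φ))
  substF-⊙ (∃' φ) = cong ∃' (trans (substF-⊙ φ) (substF-cong exts-⊙ φ))

  substT-id : ∀ t → substT var t ≡ t
  substT-id (var k) = refl
  substT-id (con φ) = refl

  substTs-id : (ts : Vec Term n) → substTs var ts ≡ ts
  substTs-id [] = refl
  substTs-id (t ∷ ts) = cong₂ _∷_ (substT-id t) (substTs-id ts)

  exts-var : exts var ≗ var
  exts-var zero = refl
  exts-var (suc k) = refl

  substF-id : ∀ φ → substF var φ ≡ φ
  substF-id (rel R ts) = cong (rel R) (substTs-id ts)
  substF-id ⊥' = refl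
  substF-id (φ ∧' ψ) = cong₂ _∧'_ (substF-id φ) (substF-id ψ)
  substF-id (φ ∨' ψ) = cong₂ _∨'_ (substF-id φ) (substF-id ψ)
  substF-id (φ ⇒ ψ) = cong₂ _⇒_ (substF-id φ) (substF-id ψ)
  substF-id (∀' φ) = cong ∀' (trans (substF-cong exts-var φ) (substF-id φ))
  substF-id (∃' φ) = cong ∃' (trans (substF-cong exts-var φ) (substF-id φ))

  substF-exts-shiftF : ∀ σ φ → substF (exts σ) (shiftF φ) ≡ shiftF (substF σ φ)
  substF-exts-shiftF σ φ = begin
    substF (exts σ) (shiftF φ)  ≡⟨ substF-⊙ φ ⟩
    substF (exts σ ⊙ ↑) φ       ≡⟨ substF-cong (λ k → sym (substT-↑ (σ k))) φ ⟩
    substF (↑ ⊙ σ) φ            ≡⟨ substF-⊙ φ ⟨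
    shiftF (substF σ φ)         ∎
    where open ≡-Reasoning

  substF-[] : ∀ σ φ t → substF σ (φ [ t ]) ≡ substF (exts σ) φ [ substT σ t ]
  substF-[] σ φ t = begin
    substF σ (φ [ t ])                     ≡⟨ substF-⊙ φ ⟩
    substF (σ ⊙ sub0 t) φ                  ≡⟨ substF-cong pointwise φ ⟩
    substF (sub0 (substT σ t) ⊙ exts σ) φ  ≡⟨ substF-⊙ φ ⟨
    substF (exts σ) φ [ substT σ t ]       ∎
    where
    open ≡-Reasoning
    pointwise : σ ⊙ sub0 t ≗ sub0 (substT σ t) ⊙ exts σ
    pointwise zero = refl
    pointwise (suc k) = sym (substT-sub0-shiftT (substT σ t) (σ k))

  substF-exts-FV1 : ∀ σ φ → FV 1 φ → substF (exts σ) φ ≡ φ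
  substF-exts-FV1 σ φ fv = trans (substF-cong-FV agree φ fv) (substF-id φ)
    where
    agree : AgreeBelow 1 (exts σ) var
    agree zero _ = refl
    agree (suc k) (s≤s ())

  substF-witness : ∀ σ φ → FV 1 φ → substF σ (φ [ con φ ]) ≡ φ [ con φ ]
  substF-witness σ φ fv = trans (substF-[] σ φ (con φ)) (cong (_[ con φ ]) (substF-exts-FV1 σ φ fv))

  WFSubst : Subst → Set
  WFSubst σ = ∀ k → WFT (σ k)

  WFT-shiftT : ∀ t → WFT t → WFT (shiftT t)
  WFT-shiftT (var k) _ = tt
  WFT-shiftT (con φ) wf = wf

  WFSubst-exts : WFSubst σ → WFSubst (exts σ)
  WFSubst-exts wf zero = tt
  WFSubst-exts {σ} wf (suc k) = WFT-shiftT (σ k) (wf k)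

  WFT-substT : WFSubst σ → ∀ t → WFT t → WFT (substT σ t)
  WFT-substT wfσ (var k) _ = wfσ k
  WFT-substT wfσ (con φ) wf = wf

  WFTs-substTs : WFSubst σ → (ts : Vec Term n) → WFTs ts → WFTs (substTs σ ts)
  WFTs-substTs wfσ [] _ = tt
  WFTs-substTs wfσ (t ∷ ts) (wf , wfs) = WFT-substT wfσ t wf , WFTs-substTs wfσ ts wfs

  WF-substF : WFSubst σ → ∀ φ → WF φ → WF (substF σ φ)
  WF-substF wfσ (rel R ts) wf = WFTs-substTs wfσ ts wf
  WF-substF wfσ ⊥' _ = tt
  WF-substF wfσ (φ ∧' ψ) (wf , wf') = WF-substF wfσ φ wf , WF-substF wfσ ψ wf'
  WF-substF wfσ (φ ∨' ψ) (wf , wf') = WF-substF wfσ φ wf , WF-substF wfσ ψ wf'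
  WF-substF wfσ (φ ⇒ ψ) (wf , wf') = WF-substF wfσ φ wf , WF-substF wfσ ψ wf'
  WF-substF wfσ (∀' φ) wf = WF-substF (WFSubst-exts wfσ) φ wf
  WF-substF wfσ (∃' φ) wf = WF-substF (WFSubst-exts wfσ) φ wf

  ⊩-subst : ∀ σ → WFSubst σ → (∀ {δ} → δ ∈ Δ → substF σ δ ∈ Θ) → Δ ⊩ φ → Θ ⊩ substF σ φ
  ⊩-subst σ wf ren (ass m) = ass (ren m)
  ⊩-subst σ wf ren (lem {φ} wfφ) = lem (WF-substF wf φ wfφ)
  ⊩-subst σ wf ren (∧I d e) = ∧I (⊩-subst σ wf ren d) (⊩-subst σ wf ren e)
  ⊩-subst σ wf ren (∧E₁ d) = ∧E₁ (⊩-subst σ wf ren d)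
  ⊩-subst σ wf ren (∧E₂ d) = ∧E₂ (⊩-subst σ wf ren d)
  ⊩-subst σ wf ren (∨I₁ {ψ = ψ} d wfψ) = ∨I₁ (⊩-subst σ wf ren d) (WF-substF wf ψ wfψ)
  ⊩-subst σ wf ren (∨I₂ {φ = φ} wfφ d) = ∨I₂ (WF-substF wf φ wfφ) (⊩-subst σ wf ren d)
  ⊩-subst σ wf ren (∨E' d e f) = ∨E' (⊩-subst σ wf ren d) (⊩-subst σ wf ren e) (⊩-subst σ wf ren f)
  ⊩-subst σ wf ren (⇒E d e) = ⇒E (⊩-subst σ wf ren d) (⊩-subst σ wf ren e)
  ⊩-subst σ wf ren (⊥E {φ} d wfφ) = ⊥E (⊩-subst σ wf ren d) (WF-substF wf φ wfφ)
  ⊩-subst {Θ = Θ} σ wf ren (∀I d) = ∀I (⊩-subst (exts σ) (WFSubst-exts wf) ren↑ d)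
    where
    ren↑ : ∀ {δ} → δ ∈ map shiftF _ → substF (exts σ) δ ∈ map shiftF Θ
    ren↑ m with ∈-map⁻ shiftF m
    ... | δ , m' , refl = subst (_∈ map shiftF Θ) (sym (substF-exts-shiftF σ δ)) (∈-map⁺ shiftF (ren m'))
  ⊩-subst σ wf ren (∀E {φ} {t} d wft) =
    subst (_ ⊩_) (sym (substF-[] σ φ t)) (∀E (⊩-subst σ wf ren d) (WFT-substT wf t wft))
  ⊩-subst σ wf ren (∃I {φ} {t} wft d) =
    ∃I (WFT-substT wf t wft) (subst (_ ⊩_) (substF-[] σ φ t) (⊩-subst σ wf ren d))
  ⊩-subst {Θ = Θ} σ wf ren (∃E' {φ} {θ} d fv e) =
    ∃E' (subst (λ χ → Θ ⊩ ∃' χ) (substF-exts-FV1 σ φ fv) (⊩-subst σ wf ren d)) fv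
        (subst (λ χ → Θ ⊩ χ ⇒ substF σ θ) (substF-witness σ φ fv) (⊩-subst σ wf ren e))

  ⊩-shift : Θ ⊩ φ → map shiftF Θ ⊩ shiftF φ
  ⊩-shift = ⊩-subst ↑ (λ _ → tt) (∈-map⁺ shiftF)

  infix 4 _⊩*_
  _⊩*_ : List Formula → List Formula → Set
  Θ ⊩* Δ = ∀ {δ} → δ ∈ Δ → Θ ⊩ δ

  ⊩-cut : Θ ⊩* Δ → Δ ⊩ φ → Θ ⊩ φ
  ⊩-cut hs (ass m) = hs m
  ⊩-cut hs (lem wf) = lem wf
  ⊩-cut hs (∧I d e) = ∧I (⊩-cut hs d) (⊩-cut hs e)
  ⊩-cut hs (∧E₁ d) = ∧E₁ (⊩-cut hs d)
  ⊩-cut hs (∧E₂ d) = ∧E₂ (⊩-cut hs d)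
  ⊩-cut hs (∨I₁ d wf) = ∨I₁ (⊩-cut hs d) wf
  ⊩-cut hs (∨I₂ wf d) = ∨I₂ wf (⊩-cut hs d)
  ⊩-cut hs (∨E' d e f) = ∨E' (⊩-cut hs d) (⊩-cut hs e) (⊩-cut hs f)
  ⊩-cut hs (⇒E d e) = ⇒E (⊩-cut hs d) (⊩-cut hs e)
  ⊩-cut hs (⊥E d wf) = ⊥E (⊩-cut hs d) wf
  ⊩-cut {Θ = Θ} hs (∀I d) = ∀I (⊩-cut hs↑ d)
    where
    hs↑ : map shiftF Θ ⊩* map shiftF _
    hs↑ m with ∈-map⁻ shiftF m
    ... | _ , m' , refl = ⊩-shift (hs m')
  ⊩-cut hs (∀E d wf) = ∀E (⊩-cut hs d) wf
  ⊩-cut hs (∃I wf d) = ∃I wf (⊩-cut hs d)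
  ⊩-cut hs (∃E' d fv e) = ∃E' (⊩-cut hs d) fv (⊩-cut hs e)

  ⊩-weaken : (∀ {δ} → δ ∈ Δ → δ ∈ Θ) → Δ ⊩ φ → Θ ⊩ φ
  ⊩-weaken inc = ⊩-cut (λ m → ass (inc m))

  infix 4 _⊢*_
  _⊢*_ : Pred Formula 0ℓ → Pred Formula 0ℓ → Set
  Γ ⊢* Γ' = ∀ {ψ} → Γ' ψ → Γ ⊢ ψ

  ⊢-ass : Γ φ → Γ ⊢ φ
  ⊢-ass {φ = φ} x = φ ∷ [] , x ∷ [] , ass (here refl)

  ⊢-mono : Γ ⊆ Γ' → Γ ⊢ φ → Γ' ⊢ φ
  ⊢-mono Γ⊆Γ' (Δ , Δ⊆Γ , d) = Δ , All.map Γ⊆Γ' Δ⊆Γ , d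

  ⊆⇒⊢* : Γ ⊆ Γ' → Γ' ⊢* Γ
  ⊆⇒⊢* Γ⊆Γ' x = ⊢-ass (Γ⊆Γ' x)

  ⊢-gather : All (Γ ⊢_) Δ → Σ[ Θ ∈ List Formula ] (All Γ Θ × Θ ⊩* Δ)
  ⊢-gather [] = [] , [] , λ ()
  ⊢-gather ((Θ₁ , Θ₁⊆Γ , d) ∷ ds) =
    let Θ₂ , Θ₂⊆Γ , ds' = ⊢-gather ds
        gathered : (Θ₁ ++ Θ₂) ⊩* _
        gathered = λ { (here refl) → ⊩-weaken ∈-++⁺ˡ d
                     ; (there m) → ⊩-weaken (∈-++⁺ʳ Θ₁) (ds' m) }
    in Θ₁ ++ Θ₂ , ++⁺ Θ₁⊆Γ Θ₂⊆Γ , gathered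

  ⊢-cut : Γ' ⊢* Γ → Γ ⊢ φ → Γ' ⊢ φ
  ⊢-cut hs (Δ , Δ⊆Γ , d) =
    let Θ , Θ⊆Γ' , Θ⊩Δ = ⊢-gather (All.map hs Δ⊆Γ) in Θ , Θ⊆Γ' , ⊩-cut Θ⊩Δ d

  ⊢*-Closure : Γ' ⊢* Γ → Γ' ⊢* Closure k Γ
  ⊢*-Closure hs (_ , d) = ⊢-cut hs d

  InL-mono : ∀ φ → i ≤ k → InL i φ → InL k φ
  InL-mono _ i≤k (wf , l) = wf , ≤-trans l i≤k

  Closure-mono : i ≤ k → Γ' ⊢* Γ → Closure i Γ ⊆ Closure k Γ'
  Closure-mono i≤k hs {φ} (φ∈L , d) = InL-mono φ i≤k φ∈L , ⊢-cut hs d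

  Basic⊆InL : (bb : Basic b) → proj₁ bb ≤ k → b ⊆ InL k
  Basic⊆InL (_ , _ , _ , b≐) i≤k {φ} x = InL-mono φ i≤k (proj₁ (proj₁ b≐ x))

  infixl 6 _+⟨_⟩_
  _+⟨_⟩_ : Pred Formula 0ℓ → ℕ → Formula → Pred Formula 0ℓ
  b +⟨ k ⟩ φ = Closure k (b ∪ ｛ φ ｝)

  ⊆-+ : b ⊆ InL k → b ⊆ b +⟨ k ⟩ φ
  ⊆-+ b⊆L x = b⊆L x , ⊢-ass (inj₁ x)

  ∈-+ : InL k φ → (b +⟨ k ⟩ φ) φ
  ∈-+ φ∈L = φ∈L , ⊢-ass (inj₂ refl)

  +-mono : b ⊆ b' → i ≤ k → b +⟨ i ⟩ φ ⊆ b' +⟨ k ⟩ φ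
  +-mono b⊆b' i≤k = Closure-mono i≤k (⊆⇒⊢* (Sum.map₁ b⊆b'))

  +-plus : b ⊆ InL k → InL k φ → Plus b (b +⟨ k ⟩ φ)
  +-plus b⊆L φ∈L = _ , _ , b⊆L , φ∈L , ≐-refl

  +-basic : (bb : Basic b) → proj₁ bb ≤ k → InL k φ → Basic (b +⟨ k ⟩ φ)
  +-basic {b = b} {k = k} {φ = φ} bb@(_ , d , d⊆b , b≐) i≤k φ∈L =
    k , φ ∷ d , ∈-+ φ∈L ∷ All.map (⊆-+ (Basic⊆InL bb i≤k)) d⊆b ,
    Closure-mono ≤-refl from-d , Closure-mono ≤-refl to-d
    where
    from-d : ⟪ φ ∷ d ⟫ ⊢* (b ∪ ｛ φ ｝)
    from-d (inj₁ x) = ⊢-mono there (proj₂ (proj₁ b≐ x))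
    from-d (inj₂ refl) = ⊢-ass (here refl)
    to-d : (b ∪ ｛ φ ｝) ⊢* ⟪ φ ∷ d ⟫
    to-d (here refl) = ⊢-ass (inj₂ refl)
    to-d (there m) = ⊢-ass (inj₁ (All.lookup d⊆b m))

  Plus-resp-≐ : b ≐ b' → Plus b c → Plus b' c
  Plus-resp-≐ b≐b' (φ , j , b⊆L , φ∈L , c≐) =
    φ , j , (λ x → b⊆L (proj₂ b≐b' x)) , φ∈L ,
    ≐-trans c≐ (+-mono (proj₁ b≐b') ≤-refl , +-mono (proj₂ b≐b') ≤-refl)

  IsStates-resp-≐ : b ≐ b' → ∀ H → IsStates b H → IsStates b' H
  IsStates-resp-≐ b≐b' [] _ = tt
  IsStates-resp-≐ b≐b' (s ∷ H) ((ist , plus) , isH) =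
    (ist , Plus-resp-≐ b≐b' plus) , IsStates-resp-≐ b≐b' H isH

  IsStates-++ : ∀ H → IsStates b H → IsStates b H' → IsStates b (H ++ H')
  IsStates-++ [] _ isH' = isH'
  IsStates-++ (s ∷ H) (is , isH) isH' = is , IsStates-++ H isH isH'

  -- The empty conjunction is an instance of LEM: ⊥ ⇒ ⊥ would not be provable without ⇒I.
  ⋀ : List Formula → Formula
  ⋀ [] = ⊥' ∨' ¬' ⊥'
  ⋀ (φ ∷ d) = φ ∧' ⋀ d

  ⋀-InL : All (InL i) Δ → InL i (⋀ Δ)
  ⋀-InL [] = (tt , tt , tt) , z≤n
  ⋀-InL ((wf , l) ∷ φs∈L) = let wf' , l' = ⋀-InL φs∈L in (wf , wf') , ⊔-lub l l'

  ⋀-elim : φ ∈ Δ → Θ ⊩ ⋀ Δ → Θ ⊩ φ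
  ⋀-elim (here refl) d = ∧E₁ d
  ⋀-elim (there m) d = ⋀-elim m (∧E₂ d)

  ⋀-intro : Θ ⊩* Δ → Θ ⊩ ⋀ Δ
  ⋀-intro {Δ = []} _ = lem tt
  ⋀-intro {Δ = φ ∷ Δ} ds = ∧I (ds (here refl)) (⋀-intro (λ m → ds (there m)))

  ⋀-⊢* : (b ∪ ｛ ⋀ Δ ｝) ⊢* ⟪ Δ ⟫
  ⋀-⊢* φ∈Δ = _ ∷ [] , inj₂ refl ∷ [] , ⋀-elim φ∈Δ (ass (here refl))

  MT-mp : ∀ {u} → MT u (φ ⇒ ψ) → MT u φ → MT u ψ
  MT-mp mφ⇒ψ mφ = ded (_ ∷ _ ∷ [] , mφ⇒ψ ∷ mφ ∷ [] , ⇒E (ass (here refl)) (ass (there (here refl))))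

  HypSim : Pred Formula 0ℓ → PreState → Pred Formula 0ℓ → PreState → Set₁
  HypSim b t b' t' = (∀ {φ} → (b ∪ ｛ φ ｝) ⊢* bOf t → (b' ∪ ｛ φ ｝) ⊢* bOf t') × MT t ⊆ MT t'

  HypsSim : PreState → PreState → Set₁
  HypsSim u v = ∀ {t} → t ∈ HOf u → Σ[ t' ∈ PreState ] (t' ∈ HOf v × HypSim (bOf u) t (bOf v) t')

  MT-mono : ∀ {u v} → bOf u ⊆ bOf v → HypsSim u v → MT u ⊆ MT v
  MT-mono* : ∀ {u v} → bOf u ⊆ bOf v → HypsSim u v → All (MT u) Δ → All (MT v) Δ
  MT-mono bu⊆bv sim (base x) = base (bu⊆bv x)
  MT-mono bu⊆bv sim (hyp t∈ wf c mθ) =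
    let t' , t'∈ , c⇒c' , MTt⊆MTt' = sim t∈ in hyp t'∈ wf (c⇒c' c) (MTt⊆MTt' mθ)
  MT-mono bu⊆bv sim (ded (Δ , Δ⊆MT , d)) = ded (Δ , MT-mono* bu⊆bv sim Δ⊆MT , d)
  MT-mono* bu⊆bv sim [] = []
  MT-mono* bu⊆bv sim (m ∷ ms) = MT-mono bu⊆bv sim m ∷ MT-mono* bu⊆bv sim ms

  MT-++ : ∀ H → MT ⟨ b , H ⟩ ⊆ MT ⟨ b , H ++ H' ⟩
  MT-++ H = MT-mono (λ x → x) (λ t∈ → _ , ∈-++⁺ˡ t∈ , (λ c → c) , (λ m → m))

  MT-adjoin : ∀ {A} H → MT ⟨ b , H ⟩ δ → WF δ → (b ∪ ｛ δ ｝) ⊢* bOf A →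
              MT A ⊆ MT ⟨ b , H ++ A ∷ [] ⟩
  MT-adjoin H mδ wfδ c mχ = MT-mp (hyp (∈-++⁺ʳ H (here refl)) wfδ c mχ) (MT-++ H mδ)

  rebase : (w : PreState) → IsState w → Basic b' → bOf w ⊆ b' →
           Σ[ H' ∈ List PreState ] (IsState ⟨ b' , H' ⟩ × MT w ⊆ MT ⟨ b' , H' ⟩)
  rebaseHyps : ∀ H → IsStates b H → Basic b' → b ⊆ b' →
               Σ[ H' ∈ List PreState ] (IsStates b' H' × HypsSim ⟨ b , H ⟩ ⟨ b' , H' ⟩)
  rebaseHyp : (t : PreState) → IsState t → Plus b (bOf t) → Basic b' → b ⊆ b' →
              Σ[ t' ∈ PreState ] ((IsState t' × Plus b' (bOf t')) × HypSim b t b' t')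

  rebase ⟨ b , H ⟩ (_ , isH) bb' b⊆b' =
    let H' , isH' , sim = rebaseHyps H isH bb' b⊆b' in H' , (bb' , isH') , MT-mono b⊆b' sim

  rebaseHyps [] _ _ _ = [] , tt , λ ()
  rebaseHyps {b = b} {b' = b'} (t ∷ H) ((ist , plus) , isH) bb' b⊆b' =
    let t' , ist' , simt = rebaseHyp t ist plus bb' b⊆b'
        H' , isH' , sim = rebaseHyps H isH bb' b⊆b'
        sim' : HypsSim ⟨ b , t ∷ H ⟩ ⟨ b' , t' ∷ H' ⟩
        sim' = λ { (here refl) → t' , here refl , simt
                 ; (there m) → let t'' , t''∈ , simt'' = sim m in t'' , there t''∈ , simt'' }
    in t' ∷ H' , (ist' , isH') , sim'

  rebaseHyp {b = b} {b' = b'} t ist (φ , j , _ , φ∈Lj , bt≐) bb' b⊆b' =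
    let H'' , ist'' , MTt⊆ =
          rebase t ist (+-basic bb' l≤k⁺ φ∈Lk⁺) (λ x → +-mono b⊆b' j≤k⁺ (proj₁ bt≐ x))
    in ⟨ b' +⟨ k⁺ ⟩ φ , H'' ⟩ , (ist'' , +-plus (Basic⊆InL bb' l≤k⁺) φ∈Lk⁺) , answers , MTt⊆
    where
    k⁺ : ℕ
    k⁺ = j ⊔ proj₁ bb'
    j≤k⁺ : j ≤ k⁺
    j≤k⁺ = m≤m⊔n j (proj₁ bb')
    l≤k⁺ : proj₁ bb' ≤ k⁺
    l≤k⁺ = m≤n⊔m j (proj₁ bb')
    φ∈Lk⁺ : InL k⁺ φ
    φ∈Lk⁺ = InL-mono φ j≤k⁺ φ∈Lj
    answers : ∀ {ψ} → (b ∪ ｛ ψ ｝) ⊢* bOf t → (b' ∪ ｛ ψ ｝) ⊢* b' +⟨ k⁺ ⟩ φ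
    answers c = ⊢*-Closure λ where
      (inj₁ x) → ⊢-ass (inj₁ x)
      (inj₂ refl) → ⊢-mono (Sum.map₁ b⊆b') (c (proj₂ bt≐ (∈-+ φ∈Lj)))

  ≤Fp-refl : ∀ u → u ≤Fp u
  ≤Fs-⊆ : ∀ H → (∀ {t} → t ∈ H → t ∈ H') → ≤Fs H H'
  ≤Fp-refl ⟨ b , H ⟩ = ≐-refl , ≤Fs-⊆ H (λ t∈ → t∈)
  ≤Fs-⊆ [] _ = lift tt
  ≤Fs-⊆ (s ∷ H) H⊆H' = (s , H⊆H' (here refl) , ≤Fp-refl s) , ≤Fs-⊆ H (λ t∈ → H⊆H' (there t∈))

  ≤Fs-lookup : ≤Fs H H' → t ∈ H → Σ[ t' ∈ PreState ] (t' ∈ H' × t ≤Fp t')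
  ≤Fs-lookup {H = _ ∷ _} (found , _) (here refl) = found
  ≤Fs-lookup {H = _ ∷ _} (_ , rest) (there t∈) = ≤Fs-lookup rest t∈

  ≤Fp-trans : ∀ u v w → u ≤Fp v → v ≤Fp w → u ≤Fp w
  ≤Fs-trans : ∀ H → ≤Fs H H' → ≤Fs H' H'' → ≤Fs H H''
  ≤Fp-trans ⟨ _ , H ⟩ ⟨ _ , _ ⟩ ⟨ _ , _ ⟩ (b≐b' , H≤H') (b'≐b'' , H'≤H'') =
    ≐-trans b≐b' b'≐b'' , ≤Fs-trans H H≤H' H'≤H''
  ≤Fs-trans [] _ _ = lift tt
  ≤Fs-trans (s ∷ H) ((t , t∈ , s≤t) , H≤H') H'≤H'' =
    let t' , t'∈ , t≤t' = ≤Fs-lookup H'≤H'' t∈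
    in (t' , t'∈ , ≤Fp-trans s t t' s≤t t≤t') , ≤Fs-trans H H≤H' H'≤H''

  adjoin : ∀ {bv Hv} (bbv : Basic bv) → IsStates bv Hv →
           proj₁ bbv ≤ k → InL k δ → MT ⟨ bv , Hv ⟩ δ →
           (w : State) → bOf (proj₁ w) ⊆ bv +⟨ k ⟩ δ →
           Σ[ s ∈ State ] (⟨ bv , Hv ⟩ ≤Fp proj₁ s × w ≤⊩ s)
  adjoin {k = k} {δ = δ} {bv = bv} {Hv = Hv} bbv isv l≤k δ∈L δ∈MTv (w , isw) w⊆ =
    let H' , isA , MTw⊆MTA = rebase w isw (+-basic bbv l≤k δ∈L) w⊆
        A = ⟨ bv +⟨ k ⟩ δ , H' ⟩
    in (⟨ bv , Hv ++ A ∷ [] ⟩ , bbv ,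
        IsStates-++ Hv isv ((isA , +-plus (Basic⊆InL bbv l≤k) δ∈L) , tt)) ,
       (≐-refl , ≤Fs-⊆ Hv ∈-++⁺ˡ) ,
       (λ mχ → MT-adjoin Hv δ∈MTv (proj₁ δ∈L) proj₂ (MTw⊆MTA mχ))

  ≤⊩-isPreorder : IsPreorder _≡_ _≤⊩_
  ≤⊩-isPreorder = record
    { isEquivalence = isEquivalence
    ; reflexive = λ { refl m → m }
    ; trans = ⊆-trans
    }

  ≤F-isPreorder : IsPreorder _≡_ _≤F_
  ≤F-isPreorder = record
    { isEquivalence = isEquivalence
    ; reflexive = λ { {u , _} refl → ≤Fp-refl u }
    ; trans = λ {u} {v} {w} → ≤Fp-trans (proj₁ u) (proj₁ v) (proj₁ w)
    }

  ≤F-locallyDirected : LocallyDirected _≤F_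
  ≤F-locallyDirected (⟨ _ , _ ⟩ , _) (⟨ bv , Hv ⟩ , bbv , isv) (⟨ bw , Hw ⟩ , _ , isw)
                     (bu≐bv , _) (bu≐bw , _) =
    (⟨ bv , Hv ++ Hw ⟩ , bbv , IsStates-++ Hv isv (IsStates-resp-≐ bw≐bv Hw isw)) ,
    (≐-refl , ≤Fs-⊆ Hv ∈-++⁺ˡ) ,
    (bw≐bv , ≤Fs-⊆ Hw (∈-++⁺ʳ Hv))
    where
    bw≐bv : bw ≐ bv
    bw≐bv = ≐-trans (≐-sym bu≐bw) bu≐bv

  ≤⊩-≤F-commute : ∀ u v w → u ≤⊩ v → u ≤F w → Σ[ s ∈ State ] (v ≤F s × w ≤⊩ s)
  ≤⊩-≤F-commute (⟨ bu , _ ⟩ , (i , d , d⊆bu , bu≐) , _) (⟨ bv , Hv ⟩ , bbv , isv) w@(⟨ bw , _ ⟩ , _)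
                u≤v (bu≐bw , _) =
    adjoin bbv isv (m≤n⊔m i _) (InL-mono (⋀ d) (m≤m⊔n i _) (⋀-InL d∈L)) ⋀d∈MTv w bw⊆
    where
    d∈L : All (InL i) d
    d∈L = All.map (λ x → proj₁ (proj₁ bu≐ x)) d⊆bu
    ⋀d∈MTv : MT ⟨ bv , Hv ⟩ (⋀ d)
    ⋀d∈MTv = ded (d , All.map (λ x → u≤v (base x)) d⊆bu , ⋀-intro ass)
    bw⊆ : bw ⊆ bv +⟨ i ⊔ proj₁ bbv ⟩ ⋀ d
    bw⊆ x = Closure-mono (m≤m⊔n i _) ⋀-⊢* (proj₁ bu≐ (proj₂ bu≐bw x))

theorem3p2 : (Rel : Set) (arity : Rel → ℕ) → let open Lang Rel arity in
    IsPreorder _≡_ _≤⊩_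
    × (IsPreorder _≡_ _≤F_ × LocallyDirected _≤F_)
    × (∀ u v w → u ≤⊩ v → u ≤F w → Σ[ s ∈ State ] (v ≤F s × w ≤⊩ s))
theorem3p2 Rel arity =
  ≤⊩-isPreorder , (≤F-isPreorder , ≤F-locallyDirected) , ≤⊩-≤F-commute
  where open IntenticStates Rel arity
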